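{- Let $T$ be a tree of total charge $1$ and let $e$ be an edge of $T$. Then the black charge rule is satisfied at $e$ if and only if the white charge rule is satisfied at $e$. If, in addition, $T$ is a blossom tree, then both charge rules are satisfied at every edge of $T$, and re-rooting $T$ at any other half-edge yields again a blossom tree.
   Context: All maps are planar, connected, considered up to orientation-preserving homeomorphism, and bipartite: vertices are black or white and each edge joins a black and a white vertex. Maps may carry half-edges attached to single vertices and lying in the infinite face. A half-edge at a white vertex is a leaf; one at a black vertex is a bud. A tree is such a map with a single face, rooted at one of its half-edges. Its charge is the number of leaves minus the number of buds, not counting the root half-edge; its total charge counts it. For an edge $e$ of a tree $T$, cutting $e$ into a leaf at its white end and a bud at its black end yields $T_e^\bullet$ (containing the black end) and $T_e^\circ$ (containing the white end), each rooted at its new half-edge. The black charge rule holds at $e$ if $T_e^\bullet$ has charge $\le1$. The white charge rule holds at $e$ if $T_e^\circ$ has charge $\ge0$. The lower subtree at $e$ is the one not containing the root of $T$. A blossom tree is a tree in which, at every edge, the lower subtree satisfies the charge rule of its colour. -}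

module Defs where

open import Data.List using (List; []; _∷_; _++_; [_])
open import Data.Integer using (ℤ; +_; -_; _+_; _≤_)
open import Data.Product using (Σ; _×_; _,_; proj₁; proj₂)
open import Data.Sum using (_⊎_; inj₁; inj₂)
open import Data.Unit using (⊤; tt)
open import Data.Empty using (⊥)

data Colour : Set where
  black white : Colour

data Opp : Colour → Colour → Set where
  bw : Opp black white
  wb : Opp white black

opp-sym : ∀ {c d} → Opp c d → Opp d c
opp-sym bw = wb
opp-sym wb = bw

-- A Node c is a vertex of colour c; its list of items is the counterclockwise
-- cyclic order of the incident edges/half-edges, starting right after the
-- distinguished slot (the root half-edge, or the edge towards the parent).
-- An item is either a half-edge (leaf if c = white, bud if c = black) or an
-- edge to a vertex of the opposite colour, with the subtree hanging from it.
data Node (c : Colour) : Set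
data Child (c : Colour) : Set where
  half : Child c
  edge : ∀ {d} → Opp c d → Node d → Child c
data Node c where
  node : List (Child c) → Node c

-- A tree rooted at a half-edge: the colour of the vertex carrying the root
-- half-edge, and the vertex (with everything else) seen from the root.
Tree : Set
Tree = Σ Colour Node

halfCharge : Colour → ℤ
halfCharge white = + 1
halfCharge black = - (+ 1)

chargeN : ∀ {c} → Node c → ℤ
chargeL : ∀ {c} → List (Child c) → ℤ
chargeN (node cs) = chargeL cs
chargeL [] = + 0
chargeL {c} (half ∷ cs) = halfCharge c + chargeL cs
chargeL (edge o m ∷ cs) = chargeN m + chargeL cs

-- charge: leaves minus buds, the root half-edge not counted
charge : Tree → ℤ
charge (c , n) = chargeN n

totalCharge : Tree → ℤ
totalCharge (c , n) = halfCharge c + chargeN n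

-- Positions of the non-root half-edges of a tree.
HPosN : ∀ {c} → Node c → Set
HPosL : ∀ {c} → List (Child c) → Set
HPosN (node cs) = HPosL cs
HPosL [] = ⊥
HPosL (half ∷ cs) = ⊤ ⊎ HPosL cs
HPosL (edge o m ∷ cs) = HPosN m ⊎ HPosL cs

HalfEdge : Tree → Set
HalfEdge (c , n) = HPosN n

EPosN : ∀ {c} → Node c → Set
EPosL : ∀ {c} → List (Child c) → Set
EPosN (node cs) = EPosL cs
EPosL [] = ⊥
EPosL (half ∷ cs) = EPosL cs
EPosL (edge o m ∷ cs) = (⊤ ⊎ EPosN m) ⊎ EPosL cs

Edge : Tree → Set
Edge (c , n) = EPosN n

-- Re-rooting.  'up' is the item that occupies the distinguished slot of the
-- current vertex once re-oriented (for the original root vertex: the old root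
-- half-edge, now an ordinary half-edge); 'before' accumulates the items
-- preceding the current position in the current vertex's list.
rerootN : ∀ {c} → Child c → (n : Node c) → HPosN n → Tree
rerootL : ∀ {c} → Child c → List (Child c) → (cs : List (Child c)) → HPosL cs → Tree
rerootN up (node cs) p = rerootL up [] cs p
rerootL {c} up before (half ∷ after) (inj₁ tt) = c , node (after ++ up ∷ before)
rerootL up before (half ∷ cs) (inj₂ p) = rerootL up (before ++ [ half ]) cs p
rerootL up before (edge o m ∷ after) (inj₁ p) =
  rerootN (edge (opp-sym o) (node (after ++ up ∷ before))) m p
rerootL up before (edge o m ∷ cs) (inj₂ p) = rerootL up (before ++ [ edge o m ]) cs p

reroot : (T : Tree) → HalfEdge T → Tree
reroot (c , n) h = rerootN half n h

-- Cutting at an edge: returns (lower subtree, upper subtree), each rooted at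
-- the new half-edge created by the cut.  The lower subtree is the one not
-- containing the root of T.
cutN : ∀ {c} → Child c → (n : Node c) → EPosN n → Tree × Tree
cutL : ∀ {c} → Child c → List (Child c) → (cs : List (Child c)) → EPosL cs → Tree × Tree
cutN up (node cs) e = cutL up [] cs e
cutL up before (half ∷ cs) e = cutL up (before ++ [ half ]) cs e
cutL {c} up before (edge {d} o m ∷ after) (inj₁ (inj₁ tt)) =
  (d , m) , (c , node (after ++ up ∷ before))
cutL up before (edge o m ∷ after) (inj₁ (inj₂ e)) =
  cutN (edge (opp-sym o) (node (after ++ up ∷ before))) m e
cutL up before (edge o m ∷ cs) (inj₂ e) = cutL up (before ++ [ edge o m ]) cs e

cut : (T : Tree) → Edge T → Tree × Tree
cut (c , n) e = cutN half n e

lowerSubtree : (T : Tree) → Edge T → Tree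
lowerSubtree T e = proj₁ (cut T e)

-- Of the two pieces (which have opposite root colours), the one containing the
-- black end of e (T_e^•) and the one containing the white end (T_e^∘).
blackPiece : Tree × Tree → Tree
blackPiece ((black , m) , u) = black , m
blackPiece ((white , m) , u) = u

whitePiece : Tree × Tree → Tree
whitePiece ((white , m) , u) = white , m
whitePiece ((black , m) , u) = u

blackSubtree : (T : Tree) → Edge T → Tree
blackSubtree T e = blackPiece (cut T e)

whiteSubtree : (T : Tree) → Edge T → Tree
whiteSubtree T e = whitePiece (cut T e)

BlackChargeRule : (T : Tree) → Edge T → Set
BlackChargeRule T e = charge (blackSubtree T e) ≤ + 1

WhiteChargeRule : (T : Tree) → Edge T → Set
WhiteChargeRule T e = + 0 ≤ charge (whiteSubtree T e)

ColourRule : Tree → Set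
ColourRule (black , m) = chargeN m ≤ + 1
ColourRule (white , m) = + 0 ≤ chargeN m

IsBlossomTree : Tree → Set
IsBlossomTree T = (e : Edge T) → ColourRule (lowerSubtree T e)

-- Cutting an edge splits the total charge between two subtrees whose roots have
-- opposite colours; with total charge 1 they have charges b and 1 − b, and
-- b ≤ 1 ⇔ 0 ≤ 1 − b, so the two rules agree and hold as soon as the lower subtree
-- satisfies its own rule.  Re-rooting turns upside down exactly the edges on the
-- path to the new root; across each of them the new lower subtree is the other
-- piece of the cut, which therefore inherits the colour rule.

module Submission where

open import Defs
open import Data.Integer using (+_)
open import Data.Product using (_×_)
open import Relation.Binary.PropositionalEquality using (_≡_)
open import Function.Bundles using (_⇔_)

open import Data.Integer using (ℤ; _+_; _-_; _≤_)
open import Data.Integer.Properties using (+-comm; +-assoc; +-identityˡ; i≤j⇒0≤j-i; 0≤i-j⇒j≤i)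
open import Data.Integer.Tactic.RingSolver using (solve-∀)
open import Data.List using (List; []; _∷_; _++_; [_])
open import Data.List.Properties using (++-assoc)
open import Data.List.Relation.Unary.All using (All; []; _∷_)
open import Data.List.Relation.Unary.All.Properties using (++⁺)
open import Data.Product using (_,_; proj₁)
open import Data.Sum using (inj₁; inj₂)
open import Data.Unit using (tt)
open import Function.Base using (_∘_)
open import Function.Bundles using (mk⇔; module Equivalence)
open import Function.Properties.Equivalence using ()
  renaming (refl to ⇔-refl; sym to ⇔-sym; trans to ⇔-trans)
open import Relation.Binary.PropositionalEquality using (refl; sym; trans; cong; subst; module ≡-Reasoning)

open Equivalence using (to; from)

i+j≡1⇒i≤1⇔0≤j : ∀ {i j} → i + j ≡ + 1 → i ≤ + 1 ⇔ + 0 ≤ j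
i+j≡1⇒i≤1⇔0≤j {i} {j} i+j≡1 =
  mk⇔ (λ i≤1 → subst (+ 0 ≤_) (sym j≡1-i) (i≤j⇒0≤j-i i≤1))
      (λ 0≤j → 0≤i-j⇒j≤i (subst (+ 0 ≤_) j≡1-i 0≤j))
  where
  i+j-i≡j : ∀ i j → (i + j) - i ≡ j
  i+j-i≡j = solve-∀

  j≡1-i : j ≡ + 1 - i
  j≡1-i = trans (sym (i+j-i≡j i j)) (cong (_- i) i+j≡1)

chargeC : ∀ {c} → Child c → ℤ
chargeC {c} half = halfCharge c
chargeC (edge o m) = chargeN m

chargeL-∷ : ∀ {c} (x : Child c) xs → chargeL (x ∷ xs) ≡ chargeC x + chargeL xs
chargeL-∷ half xs = refl
chargeL-∷ (edge o m) xs = refl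

chargeL-++ : ∀ {c} (xs ys : List (Child c)) → chargeL (xs ++ ys) ≡ chargeL xs + chargeL ys
chargeL-++ [] ys = sym (+-identityˡ (chargeL ys))
chargeL-++ (x ∷ xs) ys = begin
  chargeL (x ∷ xs ++ ys)               ≡⟨ chargeL-∷ x (xs ++ ys) ⟩
  chargeC x + chargeL (xs ++ ys)       ≡⟨ cong (λ z → chargeC x + z) (chargeL-++ xs ys) ⟩
  chargeC x + (chargeL xs + chargeL ys) ≡⟨ sym (+-assoc (chargeC x) (chargeL xs) (chargeL ys)) ⟩
  chargeC x + chargeL xs + chargeL ys   ≡⟨ cong (_+ chargeL ys) (sym (chargeL-∷ x xs)) ⟩
  chargeL (x ∷ xs) + chargeL ys         ∎
  where open ≡-Reasoning

-- The total charge of the tree, computed during a traversal at a vertex whose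
-- distinguished slot holds 'up' and whose items 'before' have already been passed.
chargeAround : ∀ {c} → Child c → List (Child c) → List (Child c) → ℤ
chargeAround up before cs = chargeL (before ++ cs) + chargeC up

chargeAround-shift : ∀ {c} (up x : Child c) before cs →
  chargeAround up (before ++ [ x ]) cs ≡ chargeAround up before (x ∷ cs)
chargeAround-shift up x before cs = cong (λ xs → chargeL xs + chargeC up) (++-assoc before [ x ] cs)

chargeAround-root : ∀ {c} (cs : List (Child c)) →
  chargeAround half [] cs ≡ totalCharge (c , node cs)
chargeAround-root {c} cs = +-comm (chargeL cs) (halfCharge c)

chargeAround-descend : ∀ {c d} (o : Opp c d) (up : Child c) before after ds →
  chargeAround (edge (opp-sym o) (node (after ++ up ∷ before))) [] ds
    ≡ chargeAround up before (edge o (node ds) ∷ after)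
chargeAround-descend o up before after ds = begin
  chargeL ds + chargeL (after ++ up ∷ before)
    ≡⟨ cong (λ z → chargeL ds + z) (trans (chargeL-++ after (up ∷ before))
                                    (cong (λ z → chargeL after + z) (chargeL-∷ up before))) ⟩
  chargeL ds + (chargeL after + (chargeC up + chargeL before))
    ≡⟨ rotate (chargeL ds) (chargeL after) (chargeC up) (chargeL before) ⟩
  chargeL before + (chargeL ds + chargeL after) + chargeC up
    ≡⟨ cong (_+ chargeC up) (sym (chargeL-++ before (edge o (node ds) ∷ after))) ⟩
  chargeL (before ++ edge o (node ds) ∷ after) + chargeC up ∎
  where
  open ≡-Reasoning
  rotate : ∀ d a u b → d + (a + (u + b)) ≡ b + (d + a) + u
  rotate = solve-∀

ChargeSplit : ℤ → Tree × Tree → Set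
ChargeSplit k ((c , m) , (d , u)) = Opp c d × (chargeN m + chargeN u ≡ k)

cutL-split : ∀ {c k} (up : Child c) before cs (e : EPosL cs) →
  chargeAround up before cs ≡ k → ChargeSplit k (cutL up before cs e)
cutL-split up before (half ∷ cs) e eq =
  cutL-split up (before ++ [ half ]) cs e (trans (chargeAround-shift up half before cs) eq)
cutL-split up before (edge o (node ds) ∷ after) (inj₁ (inj₁ tt)) eq =
  opp-sym o , trans (chargeAround-descend o up before after ds) eq
cutL-split up before (edge o (node ds) ∷ after) (inj₁ (inj₂ e)) eq =
  cutL-split (edge (opp-sym o) (node (after ++ up ∷ before))) [] ds e
    (trans (chargeAround-descend o up before after ds) eq)
cutL-split up before (edge o m ∷ cs) (inj₂ e) eq =
  cutL-split up (before ++ [ edge o m ]) cs e (trans (chargeAround-shift up (edge o m) before cs) eq)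

cut-split : ∀ {k} (T : Tree) → totalCharge T ≡ k → (e : Edge T) → ChargeSplit k (cut T e)
cut-split (c , node cs) eq e = cutL-split half [] cs e (trans (chargeAround-root cs) eq)

colourRule-complement : ∀ S U → ChargeSplit (+ 1) (S , U) → ColourRule S ⇔ ColourRule U
colourRule-complement (black , m) (white , u) (bw , eq) = i+j≡1⇒i≤1⇔0≤j eq
colourRule-complement (white , m) (black , u) (wb , eq) =
  ⇔-sym (i+j≡1⇒i≤1⇔0≤j (trans (+-comm (chargeN u) (chargeN m)) eq))

lowerRule⇔blackRule : ∀ p → ChargeSplit (+ 1) p → ColourRule (proj₁ p) ⇔ (charge (blackPiece p) ≤ + 1)
lowerRule⇔blackRule ((black , m) , (white , u)) _ = ⇔-refl
lowerRule⇔blackRule ((white , m) , (black , u)) split = colourRule-complement (white , m) (black , u) split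

lowerRule⇔whiteRule : ∀ p → ChargeSplit (+ 1) p → ColourRule (proj₁ p) ⇔ (+ 0 ≤ charge (whitePiece p))
lowerRule⇔whiteRule ((black , m) , (white , u)) split = colourRule-complement (black , m) (white , u) split
lowerRule⇔whiteRule ((white , m) , (black , u)) _ = ⇔-refl

data Blossom : ∀ {c} → Child c → Set where
  half : ∀ {c} → Blossom {c} half
  edge : ∀ {c d} {o : Opp c d} {ds} →
    ColourRule (d , node ds) → All Blossom ds → Blossom (edge o (node ds))

BlossomBelowRoot : Tree → Set
BlossomBelowRoot (c , node cs) = All Blossom cs

cutL-rules⇒all-blossom : ∀ {c} (up : Child c) before cs →
  ((e : EPosL cs) → ColourRule (proj₁ (cutL up before cs e))) → All Blossom cs
cutL-rules⇒all-blossom up before [] rules = []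
cutL-rules⇒all-blossom up before (half ∷ cs) rules =
  half ∷ cutL-rules⇒all-blossom up (before ++ [ half ]) cs rules
cutL-rules⇒all-blossom up before (edge o (node ds) ∷ after) rules =
  edge (rules (inj₁ (inj₁ tt)))
       (cutL-rules⇒all-blossom (edge (opp-sym o) (node (after ++ up ∷ before))) [] ds (rules ∘ inj₁ ∘ inj₂))
  ∷ cutL-rules⇒all-blossom up (before ++ [ edge o (node ds) ]) after (rules ∘ inj₂)

all-blossom⇒cutL-rules : ∀ {c} (up : Child c) before cs → All Blossom cs →
  (e : EPosL cs) → ColourRule (proj₁ (cutL up before cs e))
all-blossom⇒cutL-rules up before (half ∷ cs) (_ ∷ bs) e =
  all-blossom⇒cutL-rules up (before ++ [ half ]) cs bs e
all-blossom⇒cutL-rules up before (edge o (node ds) ∷ after) (edge rule bds ∷ bs) (inj₁ (inj₁ tt)) = rule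
all-blossom⇒cutL-rules up before (edge o (node ds) ∷ after) (edge rule bds ∷ bs) (inj₁ (inj₂ e)) =
  all-blossom⇒cutL-rules (edge (opp-sym o) (node (after ++ up ∷ before))) [] ds bds e
all-blossom⇒cutL-rules up before (edge o m ∷ cs) (_ ∷ bs) (inj₂ e) =
  all-blossom⇒cutL-rules up (before ++ [ edge o m ]) cs bs e

isBlossomTree⇔blossomBelowRoot : (T : Tree) → IsBlossomTree T ⇔ BlossomBelowRoot T
isBlossomTree⇔blossomBelowRoot (c , node cs) =
  mk⇔ (cutL-rules⇒all-blossom half [] cs) (all-blossom⇒cutL-rules half [] cs)

rerootL-blossom : ∀ {c} (up : Child c) before cs (p : HPosL cs) →
  Blossom up → All Blossom before → All Blossom cs → chargeAround up before cs ≡ + 1 →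
  BlossomBelowRoot (rerootL up before cs p)
rerootL-blossom up before (half ∷ after) (inj₁ tt) bup bbefore (_ ∷ bafter) _ =
  ++⁺ bafter (bup ∷ bbefore)
rerootL-blossom up before (half ∷ cs) (inj₂ p) bup bbefore (bhalf ∷ bcs) eq =
  rerootL-blossom up (before ++ [ half ]) cs p bup (++⁺ bbefore (bhalf ∷ [])) bcs
    (trans (chargeAround-shift up half before cs) eq)
rerootL-blossom {c} up before (edge {d} o (node ds) ∷ after) (inj₁ p) bup bbefore (edge rule bds ∷ bafter) eq =
  rerootL-blossom (edge (opp-sym o) (node rest)) [] ds p
    (edge (to (colourRule-complement (d , node ds) (c , node rest) (opp-sym o , eq′)) rule)
          (++⁺ bafter (bup ∷ bbefore)))
    [] bds eq′
  where
  rest : List (Child c)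
  rest = after ++ up ∷ before

  eq′ : chargeL ds + chargeL rest ≡ + 1
  eq′ = trans (chargeAround-descend o up before after ds) eq
rerootL-blossom up before (edge o m ∷ cs) (inj₂ p) bup bbefore (bedge ∷ bcs) eq =
  rerootL-blossom up (before ++ [ edge o m ]) cs p bup (++⁺ bbefore (bedge ∷ [])) bcs
    (trans (chargeAround-shift up (edge o m) before cs) eq)

reroot-blossom : (T : Tree) → totalCharge T ≡ + 1 → BlossomBelowRoot T →
  (h : HalfEdge T) → BlossomBelowRoot (reroot T h)
reroot-blossom (c , node cs) eq bcs h =
  rerootL-blossom half [] cs h half [] bcs (trans (chargeAround-root cs) eq)

lemma4 : (T : Tree) → totalCharge T ≡ + 1 →
    ((e : Edge T) → BlackChargeRule T e ⇔ WhiteChargeRule T e)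
    × (IsBlossomTree T →
        ((e : Edge T) → BlackChargeRule T e × WhiteChargeRule T e)
        × ((h : HalfEdge T) → IsBlossomTree (reroot T h)))
lemma4 T total≡1 =
  (λ e → ⇔-trans (⇔-sym (lower⇔black e)) (lower⇔white e)) ,
  λ blossom →
    (λ e → to (lower⇔black e) (blossom e) , to (lower⇔white e) (blossom e)) ,
    λ h → from (isBlossomTree⇔blossomBelowRoot (reroot T h))
               (reroot-blossom T total≡1 (to (isBlossomTree⇔blossomBelowRoot T) blossom) h)
  where
  lower⇔black : (e : Edge T) → ColourRule (lowerSubtree T e) ⇔ BlackChargeRule T e
  lower⇔black e = lowerRule⇔blackRule (cut T e) (cut-split T total≡1 e)

  lower⇔white : (e : Edge T) → ColourRule (lowerSubtree T e) ⇔ WhiteChargeRule T e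
  lower⇔white e = lowerRule⇔whiteRule (cut T e) (cut-split T total≡1 e)
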